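{- Let $a$, $b$ and $n$ be positive integers and let $h$ be a nonnegative integer. Suppose $\gcd(a,b)$ divides $n$ and $n \geq (a-1)(b-1) + abh$. Then the equation $ax+by=n$ has a solution $(x,y)$ in nonnegative integers with $bh \leq x < b(h+1)$. -}

module Defs where

{-# OPTIONS --safe #-}
-- Put m = n − abh. Bézout gives a solution of a x ≡ m (mod b); reduce it to x < b.
-- Then a x ≤ a (b − 1) = (a − 1)(b − 1) + (b − 1) < m + b, so a x > m is impossible
-- (it would force a x ≥ m + b) and the congruence lifts to a x + b y = m in ℕ.
-- Finally shift x by b h, which adds abh to the left-hand side.
module Submission where

open import Defs
open import Data.Nat using (ℕ; zero; suc; _+_; _*_; _∸_; _≤_; _<_; _≤?_; z≤n; NonZero; _%_; _/_)
open import Data.Nat.Divisibility using (_∣_; divides; ∣m+n∣m⇒∣n; ∣m⇒∣m*n)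
open import Data.Nat.DivMod using (m≡m%n+[m/n]*n; m%n<n)
open import Data.Nat.GCD using (gcd; gcd-GCD; gcd[m,n]∣m; module Bézout)
open import Data.Nat.Properties
open import Data.Nat.Tactic.RingSolver using (solve)
open import Data.List.Base using ([]; _∷_)
open import Data.Product using (Σ; _×_; _,_; ∃; ∃₂)
open import Relation.Nullary using (yes; no; contradiction)
open import Relation.Binary.PropositionalEquality
  using (_≡_; sym; trans; cong; subst; subst₂; module ≡-Reasoning)

-- Congruence modulo c, phrased additively so that no subtraction is needed.
infix 4 _≡_mod_
data _≡_mod_ (u v c : ℕ) : Set where
  congruent : ∀ A V → u + c * A ≡ v + c * V → u ≡ v mod c

*-cong-mod : ∀ t {u v c} → u ≡ v mod c → t * u ≡ t * v mod c
*-cong-mod t {u} {v} {c} (congruent A V eq) = congruent (t * A) (t * V) (begin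
  t * u + c * (t * A)  ≡⟨ solve (t ∷ u ∷ c ∷ A ∷ []) ⟩
  t * (u + c * A)      ≡⟨ cong (t *_) eq ⟩
  t * (v + c * V)      ≡⟨ solve (t ∷ v ∷ c ∷ V ∷ []) ⟩
  t * v + c * (t * V)  ∎)
  where open ≡-Reasoning

identity⇒≡mod : ∀ {d a b} → Bézout.Identity d a (suc b) → ∃ λ x → a * x ≡ d mod suc b
identity⇒≡mod {d} {a} {b} (Bézout.+- x y eq) = x , congruent 0 y (begin
  a * x + suc b * 0  ≡⟨ solve (a ∷ x ∷ b ∷ []) ⟩
  x * a              ≡⟨ sym eq ⟩
  d + y * suc b      ≡⟨ cong (d +_) (*-comm y (suc b)) ⟩
  d + suc b * y      ∎)
  where open ≡-Reasoning
-- Here d ≡ −a x modulo suc b, and −x ≡ x b.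
identity⇒≡mod {d} {a} {b} (Bézout.-+ x y eq) = x * b , congruent y (a * x) (begin
  a * (x * b) + suc b * y   ≡⟨ cong (a * (x * b) +_) (*-comm (suc b) y) ⟩
  a * (x * b) + y * suc b   ≡⟨ cong (a * (x * b) +_) (sym eq) ⟩
  a * (x * b) + (d + x * a) ≡⟨ solve (a ∷ x ∷ b ∷ d ∷ []) ⟩
  d + suc b * (a * x)       ∎)
  where open ≡-Reasoning

gcd∣⇒solvable-mod : ∀ a b {n} → gcd a (suc b) ∣ n → ∃ λ x → a * x ≡ n mod suc b
gcd∣⇒solvable-mod a b (divides t n≡t*d)
  with x , ax≡d ← identity⇒≡mod (Bézout.identity (gcd-GCD a (suc b)))
  = t * x , subst₂ (λ u v → u ≡ v mod suc b)
      t[ax]≡a[tx] (sym n≡t*d) (*-cong-mod t ax≡d)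
  where
  t[ax]≡a[tx] : t * (a * x) ≡ a * (t * x)
  t[ax]≡a[tx] = solve (t ∷ a ∷ x ∷ [])

*-+*-cancel-mod : ∀ a {r q v c} → a * (r + q * c) ≡ v mod c → a * r ≡ v mod c
*-+*-cancel-mod a {r} {q} {v} {c} (congruent A V eq) = congruent (A + a * q) V (begin
  a * r + c * (A + a * q)  ≡⟨ solve (a ∷ r ∷ c ∷ A ∷ q ∷ []) ⟩
  a * (r + q * c) + c * A  ≡⟨ eq ⟩
  v + c * V                ∎)
  where open ≡-Reasoning

≡mod⇒+* : ∀ {u v c} → u < v + c → u ≡ v mod c → ∃ λ k → u + c * k ≡ v
≡mod⇒+* {u} {v} {c} u<v+c (congruent A V eq) with V ≤? A
... | yes V≤A = A ∸ V , +-cancelʳ-≡ (c * V) _ _ (begin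
  u + c * (A ∸ V) + c * V  ≡⟨ +-assoc u _ _ ⟩
  u + (c * (A ∸ V) + c * V) ≡⟨ cong (u +_) (sym (*-distribˡ-+ c (A ∸ V) V)) ⟩
  u + c * (A ∸ V + V)      ≡⟨ cong (λ w → u + c * w) (m∸n+n≡m V≤A) ⟩
  u + c * A                ≡⟨ eq ⟩
  v + c * V                ∎)
  where open ≡-Reasoning
... | no V≰A = contradiction (+-cancelʳ-≤ (c * A) (v + c) u (begin
  v + c + c * A    ≡⟨ solve (v ∷ c ∷ A ∷ []) ⟩
  v + c * suc A    ≤⟨ +-monoʳ-≤ v (*-monoʳ-≤ c (≰⇒> V≰A)) ⟩
  v + c * V        ≡⟨ sym eq ⟩
  u + c * A        ∎)) (<⇒≱ u<v+c)
  where open ≤-Reasoning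

%-cong-mod : ∀ a {u v c} .{{_ : NonZero c}} → a * u ≡ v mod c → a * (u % c) ≡ v mod c
%-cong-mod a {u} {v} {c} au≡v = *-+*-cancel-mod a {u % c} {u / c}
  (subst (λ w → a * w ≡ v mod c) (m≡m%n+[m/n]*n u c) au≡v)

residue-bound : ∀ {a b x m} → x < b → (a ∸ 1) * (b ∸ 1) ≤ m → a * x < m + b
residue-bound {zero} {b} {x} {m} x<b _ = <-≤-trans (≤-<-trans z≤n x<b) (m≤n+m b m)
residue-bound {suc a} {suc b} {x} {m} x<b slack = begin-strict
  suc a * x    ≤⟨ *-monoʳ-≤ (suc a) (<⇒≤pred x<b) ⟩
  b + a * b    ≤⟨ +-monoʳ-≤ b slack ⟩
  b + m        <⟨ n<1+n (b + m) ⟩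
  suc (b + m)  ≡⟨ cong suc (+-comm b m) ⟩
  suc (m + b)  ≡⟨ sym (+-suc m b) ⟩
  m + suc b    ∎
  where open ≤-Reasoning

residue-solution : ∀ a b m → gcd a (suc b) ∣ m → (a ∸ 1) * b ≤ m →
  ∃₂ λ x y → a * x + suc b * y ≡ m × x < suc b
residue-solution a b m gcd∣m slack
  with x₀ , ax₀≡m ← gcd∣⇒solvable-mod a b gcd∣m
  with y , ax+by≡m ← ≡mod⇒+* (residue-bound {a} (m%n<n x₀ (suc b)) slack)
    (%-cong-mod a ax₀≡m)
  = x₀ % suc b , y , ax+by≡m , m%n<n x₀ (suc b)

corollary8 : (a b n h : ℕ) → 0 < a → 0 < b → 0 < n →
    gcd a b ∣ n → (a ∸ 1) * (b ∸ 1) + a * b * h ≤ n →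
    Σ ℕ (λ x → Σ ℕ (λ y → (a * x + b * y ≡ n) × (b * h ≤ x × x < b * suc h)))
corollary8 a b@(suc b-1) n h _ _ _ gcd∣n slack+abh≤n = shift (residue-solution a b-1 m gcd∣m slack)
  where
  open ≡-Reasoning
  m = n ∸ a * b * h
  abh+m≡n : a * b * h + m ≡ n
  abh+m≡n = m+[n∸m]≡n (≤-trans (m≤n+m (a * b * h) ((a ∸ 1) * b-1)) slack+abh≤n)
  gcd∣m : gcd a b ∣ m
  gcd∣m = ∣m+n∣m⇒∣n (subst (gcd a b ∣_) (sym abh+m≡n) gcd∣n)
                    (∣m⇒∣m*n h (∣m⇒∣m*n b (gcd[m,n]∣m a b)))
  slack : (a ∸ 1) * b-1 ≤ m
  slack = subst (_≤ m) (m+n∸n≡m _ (a * b * h)) (∸-monoˡ-≤ (a * b * h) slack+abh≤n)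
  shift : (∃₂ λ x y → a * x + b * y ≡ m × x < b) →
    Σ ℕ (λ x → Σ ℕ (λ y → (a * x + b * y ≡ n) × (b * h ≤ x × x < b * suc h)))
  shift (x , y , ax+by≡m , x<b) = b * h + x , y , (begin
    a * (b * h + x) + b * y    ≡⟨ solve (a ∷ b-1 ∷ h ∷ x ∷ y ∷ []) ⟩
    a * b * h + (a * x + b * y) ≡⟨ cong (a * b * h +_) ax+by≡m ⟩
    a * b * h + m              ≡⟨ abh+m≡n ⟩
    n                          ∎) , m≤m+n (b * h) x ,
    subst (b * h + x <_) (trans (+-comm (b * h) b) (sym (*-suc b h))) (+-monoʳ-< (b * h) x<b)
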